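{- Let $f$ be an isoarithmetic IASI of a graph $G$ such that $|f(v)|=l$ for all $v\in V(G)$. Then for any two adjacent vertices $u,v$ of $G$, there is exactly one saturated class in $f(u)\times f(v)$.
   Context: All graphs are simple and finite with no isolated vertices. Let $\mathbb{N}_0$ be the set of non-negative integers and $\mathcal{P}(\mathbb{N}_0)$ its power set; label sets are finite and non-empty. For sets $A,B$, $A+B=\{a+b: a\in A, b\in B\}$. An integer additive set-indexer (IASI) of $G$ is an injective map $f:V(G)\to\mathcal{P}(\mathbb{N}_0)$ such that $f^+:E(G)\to\mathcal{P}(\mathbb{N}_0)$, $f^+(uv)=f(u)+f(v)$, is also injective. An AP-set is a finite set of integers with at least three elements forming an arithmetic progression; its common difference is the deterministic index of the element it labels. An IASI is arithmetic if all vertex labels and all edge labels are AP-sets, and isoarithmetic if moreover all vertices and edges have the same deterministic index. For adjacent $u,v$, the compatibility class $\mathsf{C}_k$ is the set of pairs $(a,b)\in f(u)\times f(v)$ with $a+b=k$ (for $k\in f^+(uv)$). A saturated class is a compatibility class with exactly $\min(|f(u)|,|f(v)|)$ elements. -}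

module Defs where

open import Data.Nat using (ℕ; _+_; _*_; _≤_; _<_; _⊓_; _≟_)
open import Data.Fin using (Fin)
open import Data.List using (List; length; filter; cartesianProduct)
open import Data.List.Membership.Propositional using (_∈_)
open import Data.List.Relation.Unary.Unique.Propositional using (Unique)
open import Data.Product using (Σ; ∃; ∃-syntax; _×_; _,_; proj₁; proj₂)
open import Data.Sum using (_⊎_)
open import Relation.Binary.PropositionalEquality using (_≡_)
open import Relation.Nullary using (¬_)

record Graph (n : ℕ) : Set₁ where
  field
    Adj        : Fin n → Fin n → Set
    symmetric  : ∀ {u v} → Adj u v → Adj v u
    irreflexive : ∀ {u} → ¬ Adj u u
    noIsolated : ∀ u → ∃[ v ] Adj u v

-- A finite set of naturals is represented by a duplicate-free list.
-- Subsets of ℕ in general are predicates.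
Pred : Set₁
Pred = ℕ → Set

_≐_ : Pred → Pred → Set
P ≐ Q = ∀ x → (P x → Q x) × (Q x → P x)

⟦_⟧ : List ℕ → Pred
⟦ A ⟧ x = x ∈ A

_⊕_ : List ℕ → List ℕ → Pred
(A ⊕ B) x = Σ ℕ λ a → Σ ℕ λ b → a ∈ A × b ∈ B × x ≡ a + b

-- P is an AP-set (at least three elements) with common difference d.
-- (Subsets of ℕ, so the common difference is taken positive.)
IsAPSetWith : ℕ → Pred → Set
IsAPSetWith d P = 1 ≤ d × Σ ℕ λ a → Σ ℕ λ m → 3 ≤ m ×
  (P ≐ (λ x → Σ ℕ λ i → i < m × x ≡ a + i * d))

record IsIASI {n : ℕ} (G : Graph n) (f : Fin n → List ℕ) : Set where
  open Graph G
  field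
    finiteSets  : ∀ v → Unique (f v)
    nonEmpty    : ∀ v → 1 ≤ length (f v)
    injective   : ∀ u v → ⟦ f u ⟧ ≐ ⟦ f v ⟧ → u ≡ v
    edgeInjective : ∀ u v u' v' → Adj u v → Adj u' v' →
      (f u ⊕ f v) ≐ (f u' ⊕ f v') →
      (u ≡ u' × v ≡ v') ⊎ (u ≡ v' × v ≡ u')

IsIsoarithmetic : ∀ {n} (G : Graph n) (f : Fin n → List ℕ) → Set
IsIsoarithmetic G f = IsIASI G f × Σ ℕ λ d →
  (∀ v → IsAPSetWith d ⟦ f v ⟧) ×
  (∀ u v → Graph.Adj G u v → IsAPSetWith d (f u ⊕ f v))

classSize : List ℕ → List ℕ → ℕ → ℕ
classSize A B k = length (filter (λ p → proj₁ p + proj₂ p ≟ k) (cartesianProduct A B))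

Saturated : List ℕ → List ℕ → ℕ → Set
Saturated A B k = (A ⊕ B) k × classSize A B k ≡ length A ⊓ length B

-- Both labels are arithmetic progressions A = {a + i d : i ≤ p} and B = {b + j d : j ≤ p}
-- of the same length.  Since B has no repeated elements, each x ∈ A lies in at most one
-- pair of C_k, so C_k is saturated exactly when every element of A has a partner in B.
-- Pairing a + i d with b + (p ∸ i) d shows that k = a + b + p d has this property; conversely
-- the partner of the least element a bounds k from above by a + b + p d, and the partner of
-- the greatest element a + p d bounds it from below by the same number.
module Submission where

open import Defs
open import Data.Nat using (ℕ; suc; _+_; _*_; _∸_; _≤_; _<_; _≟_; z≤n; s≤s; z<s; >-nonZero)
open import Data.Nat.Properties
open import Data.Nat.Solver using (module +-*-Solver)
open import Data.Fin using (Fin)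
open import Data.List using (List; []; _∷_; length; filter; map; upTo; cartesianProduct; _++_)
open import Data.List.Properties using (filter-++; length-++; length-map; length-upTo)
open import Data.List.Membership.Propositional using (_∈_)
open import Data.List.Membership.Propositional.Properties
  using (∈-filter⁺; ∈-filter⁻; ∈-map⁺; ∈-map⁻; ∈-upTo⁺; ∈-upTo⁻)
open import Data.List.Membership.Propositional.Properties.WithK using (unique∧set⇒bag)
open import Data.List.Relation.Unary.Any using (here; there)
open import Data.List.Relation.Unary.All using ([]; _∷_)
open import Data.List.Relation.Unary.Unique.Propositional using (Unique; []; _∷_)
import Data.List.Relation.Unary.Unique.Propositional.Properties as Unique
open import Data.List.Relation.Binary.BagAndSetEquality using (∼bag⇒↭)
open import Data.List.Relation.Binary.Permutation.Propositional.Properties using (↭-length)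
open import Data.Product using (Σ; ∃-syntax; _×_; _,_; proj₁; proj₂)
open import Data.Bool using (true; false)
open import Function using (_∘_)
open import Function.Bundles using (mk⇔)
open import Relation.Nullary using (Dec; does; contradiction)
open import Relation.Unary using (Decidable)
open import Relation.Binary.PropositionalEquality
  using (_≡_; refl; sym; trans; cong; cong₂; module ≡-Reasoning)

length-filter-map : ∀ {A B : Set} {P : B → Set} (P? : Decidable P) (g : A → B) xs →
  length (filter P? (map g xs)) ≡ length (filter (P? ∘ g) xs)
length-filter-map P? g [] = refl
length-filter-map P? g (x ∷ xs) with does (P? (g x))
... | true  = cong suc (length-filter-map P? g xs)
... | false = length-filter-map P? g xs

Unique∧allEqual⇒length≤1 : ∀ {A : Set} {xs : List A} → Unique xs →
  (∀ {y z} → y ∈ xs → z ∈ xs → y ≡ z) → length xs ≤ 1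
Unique∧allEqual⇒length≤1 [] _ = z≤n
Unique∧allEqual⇒length≤1 ([] ∷ _) _ = s≤s z≤n
Unique∧allEqual⇒length≤1 ((y≢z ∷ _) ∷ _) allEqual =
  contradiction (allEqual (here refl) (there (here refl))) y≢z

∈⇒1≤length : ∀ {A : Set} {y : A} {ys} → y ∈ ys → 1 ≤ length ys
∈⇒1≤length (here _)  = s≤s z≤n
∈⇒1≤length (there _) = s≤s z≤n

1≤length⇒∈ : ∀ {A : Set} {ys : List A} → 1 ≤ length ys → ∃[ y ] y ∈ ys
1≤length⇒∈ {ys = y ∷ _} _ = y , here refl

length-≐ : ∀ {A B : List ℕ} → Unique A → Unique B → ⟦ A ⟧ ≐ ⟦ B ⟧ → length A ≡ length B
length-≐ uA uB A≐B =
  ↭-length (∼bag⇒↭ (unique∧set⇒bag uA uB (λ {x} → mk⇔ (proj₁ (A≐B x)) (proj₂ (A≐B x)))))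

+-tight : ∀ {m n o} → m ≤ 1 → n ≤ o → m + n ≡ suc o → m ≡ 1 × n ≡ o
+-tight {0}     _           n≤o refl = contradiction n≤o (<-irrefl refl)
+-tight {1}     _           _   eq   = refl , suc-injective eq
+-tight {suc (suc _)} (s≤s ()) _ _

partners : ℕ → List ℕ → ℕ → List ℕ
partners x B k = filter (λ y → x + y ≟ k) B

Partnered : List ℕ → List ℕ → ℕ → Set
Partnered A B k = ∀ {x} → x ∈ A → ∃[ y ] y ∈ B × x + y ≡ k

classSize-∷ : ∀ x A B k → classSize (x ∷ A) B k ≡ length (partners x B k) + classSize A B k
classSize-∷ x A B k = begin
  length (filter P? (map (x ,_) B ++ cartesianProduct A B))
    ≡⟨ cong length (filter-++ P? (map (x ,_) B) (cartesianProduct A B)) ⟩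
  length (filter P? (map (x ,_) B) ++ filter P? (cartesianProduct A B))
    ≡⟨ length-++ (filter P? (map (x ,_) B)) ⟩
  length (filter P? (map (x ,_) B)) + classSize A B k
    ≡⟨ cong (_+ classSize A B k) (length-filter-map P? (x ,_) B) ⟩
  length (partners x B k) + classSize A B k ∎
  where
  open ≡-Reasoning
  P? : (p : ℕ × ℕ) → Dec (proj₁ p + proj₂ p ≡ k)
  P? p = proj₁ p + proj₂ p ≟ k

length-partners≤1 : ∀ x {B} k → Unique B → length (partners x B k) ≤ 1
length-partners≤1 x {B} k uB = Unique∧allEqual⇒length≤1 (Unique.filter⁺ P? uB) allEqual
  where
  P? : (y : ℕ) → Dec (x + y ≡ k)
  P? y = x + y ≟ k
  allEqual : ∀ {y z} → y ∈ partners x B k → z ∈ partners x B k → y ≡ z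
  allEqual y∈ z∈ = +-cancelˡ-≡ x _ _
    (trans (proj₂ (∈-filter⁻ P? {xs = B} y∈)) (sym (proj₂ (∈-filter⁻ P? {xs = B} z∈))))

classSize≤length : ∀ A {B} k → Unique B → classSize A B k ≤ length A
classSize≤length []      k uB = z≤n
classSize≤length (x ∷ A) {B} k uB rewrite classSize-∷ x A B k =
  +-mono-≤ (length-partners≤1 x k uB) (classSize≤length A k uB)

partnered⇒classSize≡length : ∀ A {B k} → Unique B → Partnered A B k → classSize A B k ≡ length A
partnered⇒classSize≡length []      uB _ = refl
partnered⇒classSize≡length (x ∷ A) {B} {k} uB partnered = begin
  classSize (x ∷ A) B k                         ≡⟨ classSize-∷ x A B k ⟩
  length (partners x B k) + classSize A B k     ≡⟨ cong₂ _+_ x-has-one-partner rest ⟩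
  1 + length A                                  ∎
  where
  open ≡-Reasoning
  x-has-one-partner : length (partners x B k) ≡ 1
  x-has-one-partner with y , y∈B , x+y≡k ← partnered (here refl) =
    ≤-antisym (length-partners≤1 x k uB) (∈⇒1≤length (∈-filter⁺ (λ z → x + z ≟ k) y∈B x+y≡k))
  rest : classSize A B k ≡ length A
  rest = partnered⇒classSize≡length A uB (partnered ∘ there)

classSize≡length⇒partnered : ∀ A {B k} → Unique B → classSize A B k ≡ length A → Partnered A B k
classSize≡length⇒partnered (x ∷ A) {B} {k} uB full x∈
  with one , rest ← +-tight (length-partners≤1 x k uB) (classSize≤length A k uB)
                            (trans (sym (classSize-∷ x A B k)) full)
     | x∈
... | here refl with y , y∈ ← 1≤length⇒∈ (≤-reflexive (sym one)) =
  y , ∈-filter⁻ (λ z → x + z ≟ k) {xs = B} y∈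
... | there x∈A = classSize≡length⇒partnered A uB rest x∈A

saturated⇒partnered : ∀ {A B k} → Unique B → length A ≤ length B → Saturated A B k → Partnered A B k
saturated⇒partnered {A} uB |A|≤|B| (_ , saturated) =
  classSize≡length⇒partnered A uB (trans saturated (m≤n⇒m⊓n≡m |A|≤|B|))

partnered⇒saturated : ∀ {A B k x} → Unique B → length A ≤ length B → x ∈ A →
  Partnered A B k → Saturated A B k
partnered⇒saturated {A} {x = x} uB |A|≤|B| x∈A partnered
  with y , y∈B , x+y≡k ← partnered x∈A =
  (x , y , x∈A , y∈B , sym x+y≡k) ,
  trans (partnered⇒classSize≡length A uB partnered) (sym (m≤n⇒m⊓n≡m |A|≤|B|))

progression : ℕ → ℕ → ℕ → Pred
progression a d m x = Σ ℕ λ i → i < m × x ≡ a + i * d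

arithProg : ℕ → ℕ → ℕ → List ℕ
arithProg a d m = map (λ i → a + i * d) (upTo m)

∈-arithProg⁺ : ∀ {a d m x} → progression a d m x → x ∈ arithProg a d m
∈-arithProg⁺ {a} {d} (i , i<m , refl) = ∈-map⁺ (λ i → a + i * d) (∈-upTo⁺ i<m)

∈-arithProg⁻ : ∀ {a d m x} → x ∈ arithProg a d m → progression a d m x
∈-arithProg⁻ {a} {d} x∈ with i , i∈ , refl ← ∈-map⁻ (λ i → a + i * d) x∈ = i , ∈-upTo⁻ i∈ , refl

arithProg-unique : ∀ {a d} m → 1 ≤ d → Unique (arithProg a d m)
arithProg-unique {a} {d} m 1≤d = Unique.map⁺ injective (Unique.upTo⁺ m)
  where
  injective : ∀ {i j} → a + i * d ≡ a + j * d → i ≡ j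
  injective eq = *-cancelʳ-≡ _ _ d {{>-nonZero 1≤d}} (+-cancelˡ-≡ a _ _ eq)

length-progression : ∀ {A a d m} → 1 ≤ d → Unique A → ⟦ A ⟧ ≐ progression a d m → length A ≡ m
length-progression {A} {a} {d} {m} 1≤d uA A≐ = begin
  length A                           ≡⟨ length-≐ uA (arithProg-unique m 1≤d) A≐arithProg ⟩
  length (arithProg a d m)           ≡⟨ length-map _ (upTo m) ⟩
  length (upTo m)                    ≡⟨ length-upTo m ⟩
  m                                  ∎
  where
  open ≡-Reasoning
  A≐arithProg : ⟦ A ⟧ ≐ ⟦ arithProg a d m ⟧
  A≐arithProg x = ∈-arithProg⁺ ∘ proj₁ (A≐ x) , proj₂ (A≐ x) ∘ ∈-arithProg⁻

progression-sum : ∀ a b d i j → (a + i * d) + (b + j * d) ≡ a + b + (i + j) * d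
progression-sum = solve 5 (λ a b d i j → (a :+ i :* d) :+ (b :+ j :* d) := a :+ b :+ (i :+ j) :* d) refl
  where open +-*-Solver

module _ {A B : List ℕ} {a b d p : ℕ}
         (A≐ : ⟦ A ⟧ ≐ progression a d (suc p)) (B≐ : ⟦ B ⟧ ≐ progression b d (suc p)) where

  partnered-at-top : Partnered A B (a + b + p * d)
  partnered-at-top x∈A with i , s≤s i≤p , refl ← proj₁ (A≐ _) x∈A =
    b + (p ∸ i) * d ,
    proj₂ (B≐ _) (p ∸ i , s≤s (m∸n≤m p i) , refl) ,
    trans (progression-sum a b d i (p ∸ i)) (cong (λ n → a + b + n * d) (m+[n∸m]≡n i≤p))

  private
    partner-index : ∀ {x k} → Partnered A B k → x ∈ A → Σ ℕ λ j → j ≤ p × x + (b + j * d) ≡ k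
    partner-index partnered x∈A with _ , y∈B , x+y≡k ← partnered x∈A
                                 with j , s≤s j≤p , refl ← proj₁ (B≐ _) y∈B = j , j≤p , x+y≡k

  partnered⇒top : ∀ {k} → Partnered A B k → k ≡ a + b + p * d
  partnered⇒top {k} partnered = ≤-antisym upper lower
    where
    open ≤-Reasoning
    upper : k ≤ a + b + p * d
    upper with j , j≤p , eq ← partner-index partnered (proj₂ (A≐ _) (0 , z<s , refl)) = begin
      k                        ≡⟨ sym eq ⟩
      a + 0 * d + (b + j * d)  ≡⟨ progression-sum a b d 0 j ⟩
      a + b + j * d            ≤⟨ +-monoʳ-≤ (a + b) (*-monoˡ-≤ d j≤p) ⟩
      a + b + p * d            ∎
    lower : a + b + p * d ≤ k
    lower with j , _ , eq ← partner-index partnered (proj₂ (A≐ _) (p , ≤-refl , refl)) = begin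
      a + b + p * d            ≤⟨ +-monoʳ-≤ (a + b) (*-monoˡ-≤ d (m≤m+n p j)) ⟩
      a + b + (p + j) * d      ≡⟨ sym (progression-sum a b d p j) ⟩
      a + p * d + (b + j * d)  ≡⟨ eq ⟩
      k                        ∎

  uniqueSaturatedClass : Unique B → length A ≡ length B →
    Σ ℕ λ k → Saturated A B k × (∀ k' → Saturated A B k' → k' ≡ k)
  uniqueSaturatedClass uB |A|≡|B| =
    a + b + p * d ,
    partnered⇒saturated uB |A|≤|B| (proj₂ (A≐ _) (0 , z<s , refl)) partnered-at-top ,
    λ k' saturated → partnered⇒top (saturated⇒partnered uB |A|≤|B| saturated)
    where
    |A|≤|B| : length A ≤ length B
    |A|≤|B| = ≤-reflexive |A|≡|B|

corollary2p11 : ∀ {n} (G : Graph n) (f : Fin n → List ℕ) (l : ℕ) →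
    IsIsoarithmetic G f → (∀ v → length (f v) ≡ l) →
    ∀ u v → Graph.Adj G u v →
    Σ ℕ λ k → Saturated (f u) (f v) k × (∀ k' → Saturated (f u) (f v) k' → k' ≡ k)
corollary2p11 G f l (iasi , d , vertexAP , _) |f|≡l u v _
  with 1≤d , a , suc p , s≤s _ , fu≐ ← vertexAP u
     | _ , b , m , _ , fv≐ ← vertexAP v
  with refl ← trans (sym (length-progression 1≤d (IsIASI.finiteSets iasi u) fu≐))
                    (trans (|f|≡l u) (trans (sym (|f|≡l v))
                      (length-progression 1≤d (IsIASI.finiteSets iasi v) fv≐)))
  = uniqueSaturatedClass fu≐ fv≐ (IsIASI.finiteSets iasi v) (trans (|f|≡l u) (sym (|f|≡l v)))
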